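{- Let $k\ge3$, $i\in\mathbb{N}$ and $1\le b\le k-1$, and set $B=(ki)\oplus(0.b)=(ki\,.\,ki+b)$. Then, as formal power series, \[ C_B^{(k)}(y) = C_{b+ki}^{(k)}(y) = y^{b+ki}\,\bigl(H_{k-1}(y)\bigr)^{i+1}. \]
   Context: Words are over the alphabet $\mathbb{N}=\{0,1,2,\dots\}$; $(x.y)$ denotes the length-2 word with letters $x,y$; $n\oplus W$ adds $n$ to every letter of $W$. For $k\ge 2$, $\phi_k$ is the morphism of $\mathbb{N}^*$ defined for $i\in\mathbb{N}$, $0\le j\le k-1$ by $\phi_k(ki+j)=(ki)(ki+j+1)$ if $0\le j\le k-2$ and $\phi_k(ki+k-1)=ki+k$; $W_n^{(k)}=\phi_k^n(0)$. For a nonempty word $B$ (possibly a single digit), $c^{(k)}(B;n)$ is the number of (possibly overlapping) occurrences of $B$ in $W_n^{(k)}$ and $C_B^{(k)}(y)=\sum_{n\ge0}c^{(k)}(B;n)y^n$. $H_{k-1}(y)=1/(1-y-\cdots-y^{k-1})$ as a formal power series. -}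

module Defs where

open import Data.Nat using (ℕ; zero; suc; _+_; _*_; _∸_; _<ᵇ_; _≡ᵇ_; _≤?_)
open import Data.Nat.DivMod using (_/_; _%_)
open import Data.Bool using (Bool; true; false; if_then_else_; _∧_)
open import Data.List using (List; []; _∷_; concatMap; take)
open import Data.Nat.ListAction using (sum)
open import Function using (_∘_)
open import Relation.Nullary using (yes; no)

-- The morphism φ_k on a single letter m = k q + j (0 ≤ j ≤ k-1):
--   φ_k(kq+j) = (kq)(kq+j+1)   if j ≤ k-2
--   φ_k(kq+k-1) = kq+k.
-- For k = 0 the value is junk (the theorem only uses k ≥ 3).
φ : ℕ → ℕ → List ℕ
φ zero m = []
φ (suc k') m =
  if suc (m % suc k') <ᵇ suc k'
  then suc k' * (m / suc k') ∷ suc k' * (m / suc k') + suc (m % suc k') ∷ []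
  else suc k' * (m / suc k') + suc k' ∷ []

φ* : ℕ → List ℕ → List ℕ
φ* k = concatMap (φ k)

W : ℕ → ℕ → List ℕ
W k zero = 0 ∷ []
W k (suc n) = φ* k (W k n)

isPrefix : List ℕ → List ℕ → Bool
isPrefix [] w = true
isPrefix (b ∷ bs) [] = false
isPrefix (b ∷ bs) (x ∷ xs) = (b ≡ᵇ x) ∧ isPrefix bs xs

-- number of (possibly overlapping) occurrences of B in w
-- (B is assumed nonempty, as in the paper)
occ : List ℕ → List ℕ → ℕ
occ B [] = 0
occ B (x ∷ xs) = (if isPrefix B (x ∷ xs) then 1 else 0) + occ B xs

-- c^{(k)}(B;n); a formal power series is represented by its coefficient
-- sequence ℕ → ℕ, so C_B^{(k)} is the function n ↦ c^{(k)}(B;n).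
C : ℕ → List ℕ → ℕ → ℕ
C k B n = occ B (W k n)

Series : Set
Series = ℕ → ℕ

conv : Series → Series → Series
conv f g n = go n
  where
  go : ℕ → ℕ
  go zero = f 0 * g n
  go (suc j) = f (suc j) * g (n ∸ suc j) + go j

one : Series
one zero = 1
one (suc n) = 0

pow : Series → ℕ → Series
pow f zero = one
pow f (suc m) = conv f (pow f m)

shift : ℕ → Series → Series
shift d f n with d ≤? n
... | yes _ = f (n ∸ d)
... | no _ = 0

-- hList k n = [h n, h (n-1), …, h 0] where h are the coefficients of
-- H_{k-1}(y) = 1/(1 - y - … - y^{k-1}), i.e. h 0 = 1 and
-- h (n+1) = Σ_{j=1}^{k-1} h (n+1-j)  (terms with negative index omitted).
hList : ℕ → ℕ → List ℕ
hList k zero = 1 ∷ []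
hList k (suc n) = sum (take (k ∸ 1) (hList k n)) ∷ hList k n

H : ℕ → Series
H k n with hList k n
... | [] = 0
... | x ∷ _ = x

{-# OPTIONS --safe #-}
-- Write k = K + 1 and a letter as k a + r with r ≤ K.  Then φ_k (k a + r) = (k a) (k a + r + 1) for
-- r < K and φ_k (k a + K) = k (a + 1).  So a letter k a + j with 1 ≤ j ≤ K only arises as the second
-- letter of φ_k (k a + j - 1): it is always preceded by k a, which gives the first equality, and it
-- occurs in W_n as often as k a + j - 1 occurs in W_(n-1), hence as often as k a occurs in W_(n-j).
-- The letter k q arises as the first letter of φ_k (k q + r), r < K, and as φ_k (k q - 1), so its
-- counting series D_q satisfies D_q = (y + ⋯ + y^K) D_q + A_q with A_0 = 1 and A_(q+1) = y^k D_q.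
-- This determines D_q = H_K A_q, and by induction on q, D_q = y^(kq) H_K^(q+1).
module Submission where

open import Defs
open import Data.Nat using (ℕ; zero; suc; _+_; _*_; _∸_; _≤_; _<_; _≡ᵇ_; _<ᵇ_; _≟_; _≤?_; _<?_; z≤n; s≤s; z<s; s<s)
open import Data.Nat.Properties
open import Data.Nat.DivMod using (_/_; _%_; m≡m%n+[m/n]*n; %-remove-+ˡ; m<n⇒m%n≡m; m%n<n; +-distrib-/-∣ˡ; m*n/n≡m; m<n⇒m/n≡0)
open import Data.Nat.Divisibility using (m∣m*n)
open import Data.Nat.Induction using (<-rec)
open import Data.Nat.ListAction using (sum)
open import Data.Nat.ListAction.Properties using (sum-++)
open import Data.Bool using (Bool; true; false; if_then_else_; _∧_)
open import Data.Bool.Properties using (∧-identityʳ; ∧-zeroʳ)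
open import Data.List using (List; []; _∷_; _++_; map; take; applyDownFrom)
open import Data.List.Properties using (map-++; map-∘)
open import Data.Product using (_×_; _,_; proj₁; proj₂)
open import Data.Sum using (inj₁; inj₂)
open import Function using (_∘_)
open import Relation.Nullary using (yes; no)
open import Relation.Nullary.Decidable using (dec-true; dec-false)
open import Relation.Binary.PropositionalEquality
open import Algebra.Properties.CommutativeSemigroup +-commutativeSemigroup using (interchange)

open ≡-Reasoning

sumBelow : ℕ → (ℕ → ℕ) → ℕ
sumBelow zero    f = 0
sumBelow (suc t) f = f 0 + sumBelow t (f ∘ suc)

syntax sumBelow t (λ j → e) = ∑[ j < t ] e

∑-cong : ∀ t {f g : ℕ → ℕ} → (∀ {j} → j < t → f j ≡ g j) → sumBelow t f ≡ sumBelow t g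
∑-cong zero    f≡g = refl
∑-cong (suc t) f≡g = cong₂ _+_ (f≡g z<s) (∑-cong t (f≡g ∘ s<s))

∑-zero : ∀ t → ∑[ j < t ] 0 ≡ 0
∑-zero zero    = refl
∑-zero (suc t) = ∑-zero t

∑-distrib-+ : ∀ t (f g : ℕ → ℕ) → ∑[ j < t ] (f j + g j) ≡ sumBelow t f + sumBelow t g
∑-distrib-+ zero    f g = refl
∑-distrib-+ (suc t) f g =
  trans (cong (f 0 + g 0 +_) (∑-distrib-+ t (f ∘ suc) (g ∘ suc))) (interchange (f 0) (g 0) _ _)

*-distribˡ-∑ : ∀ t m (f : ℕ → ℕ) → m * sumBelow t f ≡ ∑[ j < t ] (m * f j)
*-distribˡ-∑ zero    m f = *-zeroʳ m
*-distribˡ-∑ (suc t) m f =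
  trans (*-distribˡ-+ m (f 0) _) (cong (m * f 0 +_) (*-distribˡ-∑ t m (f ∘ suc)))

indicator : Bool → ℕ
indicator b = if b then 1 else 0

δ : ℕ → ℕ → ℕ
δ m n = indicator (m ≡ᵇ n)

δ-refl : ∀ m → δ m m ≡ 1
δ-refl m = cong indicator (dec-true (m ≟ m) refl)

δ-≢ : ∀ {m n} → m ≢ n → δ m n ≡ 0
δ-≢ {m} {n} m≢n = cong indicator (dec-false (m ≟ n) m≢n)

δ-injective : ∀ {f : ℕ → ℕ} → (∀ {m n} → f m ≡ f n → m ≡ n) → ∀ m n → δ (f m) (f n) ≡ δ m n
δ-injective {f} f-inj m n with m ≟ n
... | yes refl = trans (δ-refl (f m)) (sym (δ-refl m))
... | no  m≢n  = trans (δ-≢ (m≢n ∘ f-inj)) (sym (δ-≢ m≢n))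

δ-+ˡ : ∀ m {j r} → δ (m + j) (m + r) ≡ δ j r
δ-+ˡ zero    = refl
δ-+ˡ (suc m) = δ-+ˡ m

∑-δ-< : ∀ {r t} → r < t → ∑[ j < t ] δ j r ≡ 1
∑-δ-< {zero}  {suc t} _         = cong suc (∑-zero t)
∑-δ-< {suc r} {suc t} (s<s r<t) = ∑-δ-< r<t

∑-δ-self : ∀ t → ∑[ j < t ] δ j t ≡ 0
∑-δ-self zero    = refl
∑-δ-self (suc t) = ∑-δ-self t

count : ℕ → List ℕ → ℕ
count m w = sum (map (δ m) w)

occ-singleton : ∀ m w → occ (m ∷ []) w ≡ count m w
occ-singleton m []      = refl
occ-singleton m (x ∷ w) = cong₂ _+_ (cong indicator (∧-identityʳ (m ≡ᵇ x))) (occ-singleton m w)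

count-++ : ∀ m xs ys → count m (xs ++ ys) ≡ count m xs + count m ys
count-++ m xs ys = trans (cong sum (map-++ (δ m) xs ys)) (sum-++ (map (δ m) xs) _)

count-suc-map-suc : ∀ m w → count (suc m) (map suc w) ≡ count m w
count-suc-map-suc m w = cong sum (sym (map-∘ w))

count-zero-map-suc : ∀ w → count 0 (map suc w) ≡ 0
count-zero-map-suc []      = refl
count-zero-map-suc (x ∷ w) = count-zero-map-suc w

infixl 6 _+ₛ_

_+ₛ_ : Series → Series → Series
(f +ₛ g) n = f n + g n

delay : ℕ → Series → Series
delay zero    f n       = f n
delay (suc d) f zero    = 0
delay (suc d) f (suc n) = delay d f n

delay-≤ : ∀ {d n} f → d ≤ n → delay d f n ≡ f (n ∸ d)
delay-≤ {zero}  f z≤n       = refl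
delay-≤ {suc d} f (s≤s d≤n) = delay-≤ f d≤n

delay-> : ∀ {d n} f → n < d → delay d f n ≡ 0
delay-> {suc d} {zero}  f _         = refl
delay-> {suc d} {suc n} f (s<s n<d) = delay-> f n<d

shift≗delay : ∀ d f → shift d f ≗ delay d f
shift≗delay d f n with d ≤? n
... | yes d≤n = sym (delay-≤ f d≤n)
... | no  d≰n = sym (delay-> f (≰⇒> d≰n))

delay-cong : ∀ d {f g} → f ≗ g → delay d f ≗ delay d g
delay-cong zero    f≗g n       = f≗g n
delay-cong (suc d) f≗g zero    = refl
delay-cong (suc d) f≗g (suc n) = delay-cong d f≗g n

delay-+ₛ : ∀ d f g → delay d (f +ₛ g) ≗ delay d f +ₛ delay d g
delay-+ₛ zero    f g n       = refl
delay-+ₛ (suc d) f g zero    = refl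
delay-+ₛ (suc d) f g (suc n) = delay-+ₛ d f g n

delay-delay : ∀ d e f → delay (d + e) f ≗ delay d (delay e f)
delay-delay zero    e f n       = refl
delay-delay (suc d) e f zero    = refl
delay-delay (suc d) e f (suc n) = delay-delay d e f n

-- window t f = (y + ⋯ + y^t) f, so that Solves t A X below says X = A / (1 - y - ⋯ - y^t).
window : ℕ → Series → Series
window t       f zero    = 0
window zero    f (suc n) = 0
window (suc t) f (suc n) = f n + window t f n

window-zero : ∀ f → window 0 f ≗ λ _ → 0
window-zero f zero    = refl
window-zero f (suc n) = refl

window-suc : ∀ t f → window (suc t) f ≗ delay 1 f +ₛ delay 1 (window t f)
window-suc t f zero    = refl
window-suc t f (suc n) = refl

window-below : ∀ t {f g n} → (∀ {m} → m < n → f m ≡ g m) → window t f n ≡ window t g n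
window-below t       {n = zero}  f≡g = refl
window-below zero    {n = suc n} f≡g = refl
window-below (suc t) {n = suc n} f≡g =
  cong₂ _+_ (f≡g ≤-refl) (window-below t (f≡g ∘ m<n⇒m<1+n))

window-cong : ∀ t {f g} → f ≗ g → window t f ≗ window t g
window-cong t f≗g n = window-below t {n = n} (λ {m} _ → f≗g m)

window-∑ : ∀ t f n → window t f (suc n) ≡ ∑[ j < t ] delay j f n
window-∑ zero    f n       = refl
window-∑ (suc t) f zero    = cong (f 0 +_) (sym (∑-zero t))
window-∑ (suc t) f (suc n) = cong (f (suc n) +_) (window-∑ t f n)

sum-take-applyDownFrom : ∀ t f n → sum (take t (applyDownFrom f n)) ≡ window t f n
sum-take-applyDownFrom zero    f zero    = refl
sum-take-applyDownFrom (suc t) f zero    = refl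
sum-take-applyDownFrom zero    f (suc n) = refl
sum-take-applyDownFrom (suc t) f (suc n) = cong (f n +_) (sum-take-applyDownFrom t f n)

delay1-window : ∀ t f → delay 1 (window t f) ≗ window t (delay 1 f)
delay1-window t       f zero          = refl
delay1-window zero    f (suc n)       = window-zero f n
delay1-window (suc t) f (suc zero)    = refl
delay1-window (suc t) f (suc (suc n)) = cong (f n +_) (delay1-window t f (suc n))

delay-window : ∀ d t f → delay d (window t f) ≗ window t (delay d f)
delay-window zero    t f n = refl
delay-window (suc d) t f n = begin
  delay (suc d) (window t f) n    ≡⟨ delay-delay 1 d (window t f) n ⟩
  delay 1 (delay d (window t f)) n ≡⟨ delay-cong 1 (delay-window d t f) n ⟩
  delay 1 (window t (delay d f)) n ≡⟨ delay1-window t (delay d f) n ⟩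
  window t (delay 1 (delay d f)) n ≡⟨ window-cong t (delay-delay 1 d f) n ⟨
  window t (delay (suc d) f) n     ∎

-- `conv` sums through a local helper that cannot be named outside Defs.  Abstracting `suc m` in
-- the one-step unfolding of `conv` turns `convUpTo` into a pattern unification problem whose
-- solution is that helper: convUpTo f g n j = Σ_{i ≤ j} f i * g (n ∸ i).
mutual
  convUpTo : Series → Series → ℕ → ℕ → ℕ
  convUpTo = _

  private
    conv-unfold : ∀ f g m → conv f g (suc m) ≡ f (suc m) * g (suc m ∸ suc m) + convUpTo f g (suc m) m
    conv-unfold f g m with suc m
    ... | _ = refl

convUpTo-congˡ : ∀ {f f'} g n j → f ≗ f' → convUpTo f g n j ≡ convUpTo f' g n j
convUpTo-congˡ g n zero    f≗f' = cong (_* g n) (f≗f' 0)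
convUpTo-congˡ g n (suc j) f≗f' =
  cong₂ _+_ (cong (_* g (n ∸ suc j)) (f≗f' (suc j))) (convUpTo-congˡ g n j f≗f')

convUpTo-+ₛ : ∀ f f' g n j → convUpTo (f +ₛ f') g n j ≡ convUpTo f g n j + convUpTo f' g n j
convUpTo-+ₛ f f' g n zero    = *-distribʳ-+ (g n) (f 0) (f' 0)
convUpTo-+ₛ f f' g n (suc j) = begin
  (f (suc j) + f' (suc j)) * g (n ∸ suc j) + convUpTo (f +ₛ f') g n j
    ≡⟨ cong₂ _+_ (*-distribʳ-+ (g (n ∸ suc j)) (f (suc j)) (f' (suc j))) (convUpTo-+ₛ f f' g n j) ⟩
  (f (suc j) * g (n ∸ suc j) + f' (suc j) * g (n ∸ suc j)) + (convUpTo f g n j + convUpTo f' g n j)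
    ≡⟨ interchange (f (suc j) * g (n ∸ suc j)) (f' (suc j) * g (n ∸ suc j))
                   (convUpTo f g n j) (convUpTo f' g n j) ⟩
  convUpTo f g n (suc j) + convUpTo f' g n (suc j) ∎

convUpTo-one : ∀ g n j → convUpTo one g n j ≡ g n
convUpTo-one g n zero    = +-identityʳ (g n)
convUpTo-one g n (suc j) = convUpTo-one g n j

convUpTo-zeroˡ : ∀ g n j → convUpTo (λ _ → 0) g n j ≡ 0
convUpTo-zeroˡ g n zero    = refl
convUpTo-zeroˡ g n (suc j) = convUpTo-zeroˡ g n j

convUpTo-delay1 : ∀ f g m j → convUpTo (delay 1 f) g (suc m) (suc j) ≡ convUpTo f g m j
convUpTo-delay1 f g m zero    = +-identityʳ (f 0 * g m)
convUpTo-delay1 f g m (suc j) = cong (f (suc j) * g (m ∸ suc j) +_) (convUpTo-delay1 f g m j)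

conv-congˡ : ∀ {f f'} g → f ≗ f' → conv f g ≗ conv f' g
conv-congˡ g f≗f' n = convUpTo-congˡ g n n f≗f'

conv-+ₛ : ∀ f f' g → conv (f +ₛ f') g ≗ conv f g +ₛ conv f' g
conv-+ₛ f f' g n = convUpTo-+ₛ f f' g n n

conv-one : ∀ g → conv one g ≗ g
conv-one g n = convUpTo-one g n n

conv-delay1 : ∀ f g → conv (delay 1 f) g ≗ delay 1 (conv f g)
conv-delay1 f g zero    = refl
conv-delay1 f g (suc m) = convUpTo-delay1 f g m m

conv-window : ∀ t f g → conv (window t f) g ≗ window t (conv f g)
conv-window zero f g n = begin
  conv (window 0 f) g n     ≡⟨ conv-congˡ g (window-zero f) n ⟩
  conv (λ _ → 0) g n        ≡⟨ convUpTo-zeroˡ g n n ⟩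
  0                         ≡⟨ window-zero (conv f g) n ⟨
  window 0 (conv f g) n     ∎
conv-window (suc t) f g n = begin
  conv (window (suc t) f) g n
    ≡⟨ conv-congˡ g (window-suc t f) n ⟩
  conv (delay 1 f +ₛ delay 1 (window t f)) g n
    ≡⟨ conv-+ₛ (delay 1 f) _ g n ⟩
  conv (delay 1 f) g n + conv (delay 1 (window t f)) g n
    ≡⟨ cong₂ _+_ (conv-delay1 f g n) (conv-delay1 (window t f) g n) ⟩
  delay 1 (conv f g) n + delay 1 (conv (window t f) g) n
    ≡⟨ cong (delay 1 (conv f g) n +_) (delay-cong 1 (conv-window t f g) n) ⟩
  delay 1 (conv f g) n + delay 1 (window t (conv f g)) n
    ≡⟨ window-suc t (conv f g) n ⟨
  window (suc t) (conv f g) n ∎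

Solves : ℕ → Series → Series → Set
Solves t A X = X ≗ A +ₛ window t X

solution-unique : ∀ {t A A' X Y} → A ≗ A' → Solves t A X → Solves t A' Y → X ≗ Y
solution-unique {t} {A} {A'} {X} {Y} A≗A' X-solves Y-solves = <-rec (λ n → X n ≡ Y n) step
  where
  step : ∀ n → (∀ {m} → m < n → X m ≡ Y m) → X n ≡ Y n
  step n X≡Y-below = begin
    X n                   ≡⟨ X-solves n ⟩
    A n + window t X n    ≡⟨ cong₂ _+_ (A≗A' n) (window-below t X≡Y-below) ⟩
    A' n + window t Y n   ≡⟨ Y-solves n ⟨
    Y n                   ∎

delay-solves : ∀ d {t A X} → Solves t A X → Solves t (delay d A) (delay d X)
delay-solves d {t} {A} {X} X-solves n = begin
  delay d X n                              ≡⟨ delay-cong d X-solves n ⟩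
  delay d (A +ₛ window t X) n              ≡⟨ delay-+ₛ d A (window t X) n ⟩
  delay d A n + delay d (window t X) n     ≡⟨ cong (delay d A n +_) (delay-window d t X n) ⟩
  delay d A n + window t (delay d X) n     ∎

conv-solves : ∀ {t A F} g → Solves t A F → Solves t (conv A g) (conv F g)
conv-solves {t} {A} {F} g F-solves n = begin
  conv F g n                               ≡⟨ conv-congˡ g F-solves n ⟩
  conv (A +ₛ window t F) g n               ≡⟨ conv-+ₛ A (window t F) g n ⟩
  conv A g n + conv (window t F) g n       ≡⟨ cong (conv A g n +_) (conv-window t F g n) ⟩
  conv A g n + window t (conv F g) n       ∎

hList≡applyDownFrom : ∀ k n → hList k n ≡ applyDownFrom (H k) (suc n)
hList≡applyDownFrom k zero    = refl
hList≡applyDownFrom k (suc n) = cong (H k (suc n) ∷_) (hList≡applyDownFrom k n)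

H-solves : ∀ K → Solves K one (H (suc K))
H-solves K zero    = refl
H-solves K (suc n) = begin
  sum (take K (hList (suc K) n))                       ≡⟨ cong (sum ∘ take K) (hList≡applyDownFrom (suc K) n) ⟩
  sum (take K (applyDownFrom (H (suc K)) (suc n)))     ≡⟨ sum-take-applyDownFrom K (H (suc K)) (suc n) ⟩
  window K (H (suc K)) (suc n)                         ∎

data Preceded (u v : ℕ) : List ℕ → Set where
  []    : Preceded u v []
  other : ∀ {x w} → x ≢ v → Preceded u v w → Preceded u v (x ∷ w)
  pair  : ∀ {w} → Preceded u v w → Preceded u v (u ∷ v ∷ w)

Preceded-++ : ∀ {u v xs ys} → Preceded u v xs → Preceded u v ys → Preceded u v (xs ++ ys)
Preceded-++ []            q = q
Preceded-++ (other x≢v p) q = other x≢v (Preceded-++ p q)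
Preceded-++ (pair p)      q = pair (Preceded-++ p q)

Preceded-not-prefix : ∀ {u v w} → u ≢ v → Preceded u v w → isPrefix (v ∷ []) w ≡ false
Preceded-not-prefix         u≢v []                    = refl
Preceded-not-prefix {v = v} u≢v (other {x} x≢v _)     = cong (_∧ true) (dec-false (v ≟ x) (≢-sym x≢v))
Preceded-not-prefix {u} {v} u≢v (pair _)              = cong (_∧ true) (dec-false (v ≟ u) (≢-sym u≢v))

occ-pair : ∀ {u v w} → u ≢ v → Preceded u v w → occ (u ∷ v ∷ []) w ≡ count v w
occ-pair         u≢v []                    = refl
occ-pair {u} {v} u≢v (other {x} {w} x≢v p) = begin
  indicator ((u ≡ᵇ x) ∧ isPrefix (v ∷ []) w) + occ (u ∷ v ∷ []) w
    ≡⟨ cong₂ _+_ (cong indicator (trans (cong ((u ≡ᵇ x) ∧_) (Preceded-not-prefix u≢v p)) (∧-zeroʳ _)))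
                 (occ-pair u≢v p) ⟩
  0 + count v w
    ≡⟨ cong (_+ count v w) (δ-≢ (≢-sym x≢v)) ⟨
  δ v x + count v w ∎
occ-pair {u} {v} u≢v (pair {w} p)          = begin
  indicator ((u ≡ᵇ u) ∧ ((v ≡ᵇ v) ∧ true))
    + (indicator ((u ≡ᵇ v) ∧ isPrefix (v ∷ []) w) + occ (u ∷ v ∷ []) w)
    ≡⟨ cong₂ _+_ (cong₂ (λ b c → indicator (b ∧ (c ∧ true))) (dec-true (u ≟ u) refl) (dec-true (v ≟ v) refl))
                 (cong₂ _+_ (cong (λ b → indicator (b ∧ isPrefix (v ∷ []) w)) (dec-false (u ≟ v) u≢v))
                            (occ-pair u≢v p)) ⟩
  1 + (0 + count v w)
    ≡⟨ cong₂ _+_ (δ-≢ (≢-sym u≢v)) (cong (_+ count v w) (δ-refl v)) ⟨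
  δ v u + (δ v v + count v w) ∎

module Morphism (K : ℕ) where

  k : ℕ
  k = suc K

  %-digits : ∀ a {r} → r < k → (k * a + r) % k ≡ r
  %-digits a {r} r<k = trans (%-remove-+ˡ r (m∣m*n a)) (m<n⇒m%n≡m r<k)

  /-digits : ∀ a {r} → r < k → (k * a + r) / k ≡ a
  /-digits a {r} r<k = begin
    (k * a + r) / k    ≡⟨ +-distrib-/-∣ˡ r (m∣m*n a) ⟩
    k * a / k + r / k  ≡⟨ cong₂ _+_ (trans (cong (_/ k) (*-comm k a)) (m*n/n≡m a k)) (m<n⇒m/n≡0 r<k) ⟩
    a + 0              ≡⟨ +-identityʳ a ⟩
    a                  ∎

  digits-injective : ∀ {q a j r} → j < k → r < k → k * q + j ≡ k * a + r → q ≡ a × j ≡ r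
  digits-injective {q} {a} j<k r<k eq =
    trans (sym (/-digits q j<k)) (trans (cong (_/ k) eq) (/-digits a r<k)) ,
    trans (sym (%-digits q j<k)) (trans (cong (_% k) eq) (%-digits a r<k))

  multiple≢digits : ∀ a q {j} → 0 < j → j < k → k * a ≢ k * q + j
  multiple≢digits a q 0<j j<k eq = <⇒≢ 0<j (proj₂ (digits-injective z<s j<k (trans (+-identityʳ _) eq)))

  δ-digits : ∀ q a {j r} → j < k → r < k → δ (k * q + j) (k * a + r) ≡ δ q a * δ j r
  δ-digits q a {j} {r} j<k r<k with q ≟ a
  ... | yes refl = begin
    δ (k * q + j) (k * q + r)  ≡⟨ δ-+ˡ (k * q) ⟩
    δ j r                      ≡⟨ +-identityʳ (δ j r) ⟨
    1 * δ j r                  ≡⟨ cong (_* δ j r) (δ-refl q) ⟨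
    δ q q * δ j r              ∎
  ... | no q≢a =
    trans (δ-≢ (q≢a ∘ proj₁ ∘ digits-injective j<k r<k)) (cong (_* δ j r) (sym (δ-≢ q≢a)))

  δ-multiples : ∀ q a → δ (k * q) (k * a) ≡ δ q a
  δ-multiples = δ-injective (*-cancelˡ-≡ _ _ k)

  ∑-δ-digits : ∀ q a {r} → r < k → ∑[ j < K ] δ (k * q + j) (k * a + r) ≡ δ q a * ∑[ j < K ] δ j r
  ∑-δ-digits q a {r} r<k =
    trans (∑-cong K (λ j<K → δ-digits q a (m<n⇒m<1+n j<K) r<k))
          (sym (*-distribˡ-∑ K (δ q a) (λ j → δ j r)))

  data Position : ℕ → Set where
    inner : ∀ a {r} → r < K → Position (k * a + r)
    final : ∀ a → Position (k * a + K)

  position : ∀ x → Position x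
  position x = subst Position (sym x≡digits) (classify (x / k) (m%n<n x k))
    where
    x≡digits : x ≡ k * (x / k) + x % k
    x≡digits =
      trans (m≡m%n+[m/n]*n x k) (trans (+-comm (x % k) _) (cong (_+ x % k) (*-comm (x / k) k)))
    classify : ∀ a {r} → r < k → Position (k * a + r)
    classify a r<k with m<1+n⇒m<n∨m≡n r<k
    ... | inj₁ r<K  = inner a r<K
    ... | inj₂ refl = final a

  φ-inner : ∀ a {r} → r < K → φ k (k * a + r) ≡ k * a ∷ k * a + suc r ∷ []
  φ-inner a {r} r<K rewrite %-digits a (m<n⇒m<1+n r<K) | /-digits a (m<n⇒m<1+n r<K) = cong step r<ᵇK
    where
    step : Bool → List ℕ
    step b = if b then k * a ∷ k * a + suc r ∷ [] else k * a + k ∷ []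
    r<ᵇK : (r <ᵇ K) ≡ true
    r<ᵇK = dec-true (r <? K) r<K

  final-suc : ∀ a → suc (k * a + K) ≡ k * suc a
  final-suc a = trans (sym (+-suc (k * a) K)) (trans (+-comm (k * a) k) (sym (*-suc k a)))

  φ-final : ∀ a → φ k (k * a + K) ≡ k * suc a ∷ []
  φ-final a rewrite %-digits a (n<1+n K) | /-digits a (n<1+n K) | dec-false (K <? K) (n≮n K) =
    cong (_∷ []) (trans (+-suc (k * a) K) (final-suc a))

  count-φ-digit : ∀ q {j} → j < K → ∀ x → count (k * q + suc j) (φ k x) ≡ δ (k * q + j) x
  count-φ-digit q {j} j<K x with position x
  ... | inner a {r} r<K = begin
    count (k * q + suc j) (φ k (k * a + r))
      ≡⟨ cong (count (k * q + suc j)) (φ-inner a r<K) ⟩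
    δ (k * q + suc j) (k * a) + (δ (k * q + suc j) (k * a + suc r) + 0)
      ≡⟨ cong₂ _+_ (δ-≢ (≢-sym (multiple≢digits a q z<s (s<s j<K)))) (+-identityʳ _) ⟩
    δ (k * q + suc j) (k * a + suc r)
      ≡⟨ cong₂ δ (+-suc (k * q) j) (+-suc (k * a) r) ⟩
    δ (k * q + j) (k * a + r) ∎
  ... | final a = begin
    count (k * q + suc j) (φ k (k * a + K))
      ≡⟨ cong (count (k * q + suc j)) (φ-final a) ⟩
    δ (k * q + suc j) (k * suc a) + 0
      ≡⟨ cong (_+ 0) (δ-≢ (≢-sym (multiple≢digits (suc a) q z<s (s<s j<K)))) ⟩
    0
      ≡⟨ δ-≢ (<⇒≢ j<K ∘ proj₂ ∘ digits-injective {q} {a} (m<n⇒m<1+n j<K) (n<1+n K)) ⟨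
    δ (k * q + j) (k * a + K) ∎

  count-φ*-digit : ∀ q {j} → j < K → ∀ w → count (k * q + suc j) (φ* k w) ≡ count (k * q + j) w
  count-φ*-digit q j<K []      = refl
  count-φ*-digit q {j} j<K (x ∷ w) =
    trans (count-++ (k * q + suc j) (φ k x) (φ* k w))
          (cong₂ _+_ (count-φ-digit q j<K x) (count-φ*-digit q j<K w))

  count-φ-multiple : ∀ q x → count (k * q) (φ k x) ≡ ∑[ j < K ] δ (k * q + j) x + δ (k * q) (suc x)
  count-φ-multiple q x with position x
  ... | inner a {r} r<K = begin
    count (k * q) (φ k (k * a + r))
      ≡⟨ cong (count (k * q)) (φ-inner a r<K) ⟩
    δ (k * q) (k * a) + (δ (k * q) (k * a + suc r) + 0)
      ≡⟨ cong₂ _+_ (δ-multiples q a) (trans (+-identityʳ _) second≡0) ⟩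
    δ q a + 0
      ≡⟨ cong₂ _+_ ∑≡δ (trans (cong (δ (k * q)) (sym (+-suc (k * a) r))) second≡0) ⟨
    ∑[ j < K ] δ (k * q + j) (k * a + r) + δ (k * q) (suc (k * a + r)) ∎
    where
    second≡0 : δ (k * q) (k * a + suc r) ≡ 0
    second≡0 = δ-≢ (multiple≢digits q a z<s (s<s r<K))
    ∑≡δ : ∑[ j < K ] δ (k * q + j) (k * a + r) ≡ δ q a
    ∑≡δ = trans (∑-δ-digits q a (m<n⇒m<1+n r<K))
                (trans (cong (δ q a *_) (∑-δ-< r<K)) (*-identityʳ (δ q a)))
  ... | final a = begin
    count (k * q) (φ k (k * a + K))
      ≡⟨ cong (count (k * q)) (φ-final a) ⟩
    δ (k * q) (k * suc a) + 0
      ≡⟨ +-comm _ 0 ⟩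
    0 + δ (k * q) (k * suc a)
      ≡⟨ cong₂ _+_ ∑≡0 (cong (δ (k * q)) (final-suc a)) ⟨
    ∑[ j < K ] δ (k * q + j) (k * a + K) + δ (k * q) (suc (k * a + K)) ∎
    where
    ∑≡0 : ∑[ j < K ] δ (k * q + j) (k * a + K) ≡ 0
    ∑≡0 = trans (∑-δ-digits q a (n<1+n K))
                (trans (cong (δ q a *_) (∑-δ-self K)) (*-zeroʳ (δ q a)))

  count-φ*-multiple : ∀ q w →
    count (k * q) (φ* k w) ≡ ∑[ j < K ] count (k * q + j) w + count (k * q) (map suc w)
  count-φ*-multiple q []      = cong (_+ 0) (sym (∑-zero K))
  count-φ*-multiple q (x ∷ w) = begin
    count (k * q) (φ* k (x ∷ w))
      ≡⟨ count-++ (k * q) (φ k x) (φ* k w) ⟩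
    count (k * q) (φ k x) + count (k * q) (φ* k w)
      ≡⟨ cong₂ _+_ (count-φ-multiple q x) (count-φ*-multiple q w) ⟩
    (letter + δ (k * q) (suc x)) + (rest + count (k * q) (map suc w))
      ≡⟨ interchange letter (δ (k * q) (suc x)) rest (count (k * q) (map suc w)) ⟩
    (letter + rest) + (δ (k * q) (suc x) + count (k * q) (map suc w))
      ≡⟨ cong (_+ count (k * q) (map suc (x ∷ w)))
              (∑-distrib-+ K (λ j → δ (k * q + j) x) (λ j → count (k * q + j) w)) ⟨
    ∑[ j < K ] count (k * q + j) (x ∷ w) + count (k * q) (map suc (x ∷ w)) ∎
    where
    letter rest : ℕ
    letter = ∑[ j < K ] δ (k * q + j) x
    rest   = ∑[ j < K ] count (k * q + j) w

  φ-Preceded : ∀ q {b} → b < K → ∀ x → Preceded (k * q) (k * q + suc b) (φ k x)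
  φ-Preceded q {b} b<K x with position x
  ... | inner a {r} r<K = subst (Preceded (k * q) (k * q + suc b)) (sym (φ-inner a r<K)) inner-case
    where
    inner-case : Preceded (k * q) (k * q + suc b) (k * a ∷ k * a + suc r ∷ [])
    inner-case with k * a + suc r ≟ k * q + suc b
    ... | yes eq = subst₂ (λ m n → Preceded (k * q) (k * q + suc b) (m ∷ n ∷ []))
                          (cong (k *_) (sym (proj₁ (digits-injective (s<s r<K) (s<s b<K) eq))))
                          (sym eq) (pair [])
    ... | no ≢v = other (multiple≢digits a q z<s (s<s b<K)) (other ≢v [])
  ... | final a = subst (Preceded (k * q) (k * q + suc b)) (sym (φ-final a))
                        (other (multiple≢digits (suc a) q z<s (s<s b<K)) [])

  φ*-Preceded : ∀ q {b} → b < K → ∀ w → Preceded (k * q) (k * q + suc b) (φ* k w)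
  φ*-Preceded q b<K []      = []
  φ*-Preceded q b<K (x ∷ w) = Preceded-++ (φ-Preceded q b<K x) (φ*-Preceded q b<K w)

  W-Preceded : ∀ q {b} → b < K → ∀ n → Preceded (k * q) (k * q + suc b) (W k n)
  W-Preceded q {b} b<K zero    = other (λ eq → 0≢1+n (trans eq (+-suc (k * q) b))) []
  W-Preceded q     b<K (suc n) = φ*-Preceded q b<K (W k n)

  countMultiple : ℕ → Series
  countMultiple q n = count (k * q) (W k n)

  count-W-digit : ∀ q {j} → j ≤ K → ∀ n → count (k * q + j) (W k n) ≡ delay j (countMultiple q) n
  count-W-digit q {zero}  _   n       = cong (λ m → count m (W k n)) (+-identityʳ (k * q))
  count-W-digit q {suc j} _   zero    = cong (λ m → count m (W k 0)) (+-suc (k * q) j)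
  count-W-digit q {suc j} j<K (suc n) =
    trans (count-φ*-digit q j<K (W k n)) (count-W-digit q (<⇒≤ j<K) n)

  source : ℕ → Series
  source zero    = one
  source (suc q) = delay k (countMultiple q)

  count-map-suc-W : ∀ q n → count (k * q) (map suc (W k n)) ≡ source q (suc n)
  count-map-suc-W zero    n =
    trans (cong (λ m → count m (map suc (W k n))) (*-zeroʳ k)) (count-zero-map-suc (W k n))
  count-map-suc-W (suc q) n = begin
    count (k * suc q) (map suc (W k n))          ≡⟨ cong (λ m → count m (map suc (W k n))) (final-suc q) ⟨
    count (suc (k * q + K)) (map suc (W k n))    ≡⟨ count-suc-map-suc (k * q + K) (W k n) ⟩
    count (k * q + K) (W k n)                    ≡⟨ count-W-digit q ≤-refl n ⟩
    delay K (countMultiple q) n                  ∎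

  countMultiple-solves : ∀ q → Solves K (source q) (countMultiple q)
  countMultiple-solves zero    zero    = cong (λ m → count m (W k 0)) (*-zeroʳ k)
  countMultiple-solves (suc q) zero    = refl
  countMultiple-solves q       (suc n) = begin
    count (k * q) (φ* k (W k n))
      ≡⟨ count-φ*-multiple q (W k n) ⟩
    ∑[ j < K ] count (k * q + j) (W k n) + count (k * q) (map suc (W k n))
      ≡⟨ cong₂ _+_ (∑-cong K (λ j<K → count-W-digit q (<⇒≤ j<K) n)) (count-map-suc-W q n) ⟩
    ∑[ j < K ] delay j (countMultiple q) n + source q (suc n)
      ≡⟨ cong (_+ source q (suc n)) (window-∑ K (countMultiple q) n) ⟨
    window K (countMultiple q) (suc n) + source q (suc n)
      ≡⟨ +-comm _ (source q (suc n)) ⟩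
    source q (suc n) + window K (countMultiple q) (suc n) ∎

  countMultiple≗delay-pow : ∀ q → countMultiple q ≗ delay (k * q) (pow (H k) (suc q))
  countMultiple≗delay-pow zero n =
    trans (solution-unique (sym ∘ conv-one one) (countMultiple-solves 0) (conv-solves one (H-solves K)) n)
          (cong (λ d → delay d (pow (H k) 1) n) (sym (*-zeroʳ k)))
  countMultiple≗delay-pow (suc q) =
    solution-unique source≗ (countMultiple-solves (suc q))
                    (delay-solves (k * suc q) (conv-solves P (H-solves K)))
    where
    P : Series
    P = pow (H k) (suc q)
    source≗ : delay k (countMultiple q) ≗ delay (k * suc q) (conv one P)
    source≗ n = begin
      delay k (countMultiple q) n        ≡⟨ delay-cong k (countMultiple≗delay-pow q) n ⟩
      delay k (delay (k * q) P) n        ≡⟨ delay-delay k (k * q) P n ⟨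
      delay (k + k * q) P n              ≡⟨ cong (λ d → delay d P n) (*-suc k q) ⟨
      delay (k * suc q) P n              ≡⟨ delay-cong (k * suc q) (conv-one P) n ⟨
      delay (k * suc q) (conv one P) n   ∎

  occ-pair≡occ-digit : ∀ q {b} → b < K → ∀ n →
    C k (k * q ∷ k * q + suc b ∷ []) n ≡ C k (k * q + suc b ∷ []) n
  occ-pair≡occ-digit q b<K n =
    trans (occ-pair (multiple≢digits q q z<s (s<s b<K)) (W-Preceded q b<K n)) (sym (occ-singleton _ (W k n)))

  occ-digit : ∀ q {b} → b ≤ K → C k (k * q + b ∷ []) ≗ delay (b + k * q) (pow (H k) (suc q))
  occ-digit q {b} b≤K n = begin
    C k (k * q + b ∷ []) n                      ≡⟨ occ-singleton _ (W k n) ⟩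
    count (k * q + b) (W k n)                   ≡⟨ count-W-digit q b≤K n ⟩
    delay b (countMultiple q) n                 ≡⟨ delay-cong b (countMultiple≗delay-pow q) n ⟩
    delay b (delay (k * q) (pow (H k) (suc q))) n ≡⟨ delay-delay b (k * q) _ n ⟨
    delay (b + k * q) (pow (H k) (suc q)) n     ∎

theorem5p7 : (k i b : ℕ) → 3 ≤ k → 1 ≤ b → b ≤ k ∸ 1 →
    (n : ℕ) →
      (C k (k * i ∷ k * i + b ∷ []) n ≡ C k (b + k * i ∷ []) n)
      × (C k (b + k * i ∷ []) n ≡ shift (b + k * i) (pow (H k) (1 + i)) n)
theorem5p7 (suc K) i (suc b) _ _ b<K n =
    trans (occ-pair≡occ-digit i b<K n) (cong (λ m → C k (m ∷ []) n) (+-comm (k * i) (suc b)))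
  , (begin
      C k (suc b + k * i ∷ []) n                    ≡⟨ cong (λ m → C k (m ∷ []) n) (+-comm (suc b) (k * i)) ⟩
      C k (k * i + suc b ∷ []) n                    ≡⟨ occ-digit i b<K n ⟩
      delay (suc b + k * i) (pow (H k) (suc i)) n   ≡⟨ shift≗delay (suc b + k * i) _ n ⟨
      shift (suc b + k * i) (pow (H k) (1 + i)) n   ∎)
  where open Morphism K
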